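{- Let $n\in\mathbb{N}$ and let $\omega_0'$ be a $1$-clique configuration of $K_n$ with total number of brushes $S_n=\sum_{v}\omega_0'(v)$. Then there exists a $1$-clique configuration of $K_{3n+3}$ using $2S_n+3n^2+8n+6$ brushes.
   Context: $K_n$ is the complete graph on $n$ vertices. Parallel cleaning process on a graph $G=(V,E)$ with initial configuration $\omega_0:V\to\mathbb{N}\cup\{0\}$: $D_0=V$, $t=0$; $D_t(v)=|N(v)\cap D_t|$ if $v\in D_t$, else $0$; $\rho_{t+1}=\{v\in D_t:\omega_t(v)\ge D_t(v)\}$; if $\rho_{t+1}=\emptyset$ stop with $K=t$, final dirty set $D_K$ and final configuration $\omega_K$; otherwise $D_{t+1}=D_t\setminus\rho_{t+1}$, $\omega_{t+1}(v)=\omega_t(v)-D_t(v)+|N(v)\cap\rho_{t+1}|$ for $v\in\rho_{t+1}$, $\omega_{t+1}(u)=\omega_t(u)+|N(u)\cap\rho_{t+1}|$ for $u\in D_{t+1}$, other values unchanged, and repeat with $t+1$. $\omega_0$ cleans $G$ if $D_K=\emptyset$. A $1$-clique configuration of $K_n$ (vertices $v_0,\dots,v_{n-1}$) is an initial configuration $\omega_0$ that cleans $K_n$ with final configuration $\omega_K$ such that (1) $\omega_0(v_i)\le n-1$ for all $i$, and (2) there is a one-to-one correspondence between the elements of $\{\omega_0(v_0),\dots,\omega_0(v_{n-1})\}$ and $\{\omega_K(v_0),\dots,\omega_K(v_{n-1})\}$ (i.e. $\omega_K$ is obtained from $\omega_0$ by relabeling the vertices). The number of brushes used by $\omega_0$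 is $\sum_i\omega_0(v_i)$. -}

module Defs where

open import Data.Nat using (ℕ; zero; suc; _+_; _*_; _∸_; _≤_; _≤ᵇ_)
open import Data.Bool using (Bool; true; false; _∧_; not; if_then_else_)
open import Data.Fin using (Fin)
open import Data.Fin.Properties using (_≟_)
open import Data.Vec using (tabulate)
open import Data.Vec using () renaming (sum to vsum)
open import Data.Product using (Σ; _×_)
open import Relation.Nullary.Decidable using (⌊_⌋)
open import Data.Fin.Permutation using (Permutation′; _⟨$⟩ʳ_)
open import Relation.Binary.PropositionalEquality using (_≡_)

Graph : ℕ → Set
Graph n = Fin n → Fin n → Bool

complete : (n : ℕ) → Graph n
complete n i j = not ⌊ i ≟ j ⌋

Config : ℕ → Set
Config n = Fin n → ℕ

sumV : {n : ℕ} → (Fin n → ℕ) → ℕ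
sumV {n} f = vsum (tabulate {n = n} f)

countV : {n : ℕ} → (Fin n → Bool) → ℕ
countV p = sumV (λ u → if p u then 1 else 0)

nbrCount : {n : ℕ} → Graph n → (Fin n → Bool) → Fin n → ℕ
nbrCount G S v = countV (λ u → G v u ∧ S u)

brushes : {n : ℕ} → Config n → ℕ
brushes = sumV

-- state of the parallel cleaning process: dirty set D_t and configuration ω_t
record State (n : ℕ) : Set where
  constructor ⟨_,_⟩
  field
    dirty : Fin n → Bool
    conf  : Config n
open State public

module _ {n : ℕ} (G : Graph n) (s : State n) where
  Dt : Fin n → ℕ
  Dt v = if dirty s v then nbrCount G (dirty s) v else 0

  ρ : Fin n → Bool
  ρ v = dirty s v ∧ (Dt v ≤ᵇ conf s v)

  ρnonempty : Bool
  ρnonempty = 1 ≤ᵇ countV ρ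

  step : State n
  step = ⟨ (λ v → dirty s v ∧ not (ρ v))
         , (λ v → if ρ v then conf s v ∸ Dt v + nbrCount G ρ v
                  else if dirty s v then conf s v + nbrCount G ρ v
                  else conf s v) ⟩

run : {n : ℕ} → Graph n → ℕ → State n → State n
run G zero s = s
run G (suc k) s = if ρnonempty G s then run G k (step G s) else s

-- Every non-final step removes at
-- least one vertex from D_t, so the process stops after at most n steps;
-- fuel n + 1 therefore always reaches the stopping time K.
final : {n : ℕ} → Graph n → Config n → State n
final {n} G ω₀ = run G (suc n) ⟨ (λ _ → true) , ω₀ ⟩

Cleans : {n : ℕ} → Graph n → Config n → Set
Cleans {n} G ω₀ = (v : Fin n) → dirty (final G ω₀) v ≡ false

OneClique : (n : ℕ) → Config n → Set
OneClique n ω₀ =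
  Cleans (complete n) ω₀
  × ((v : Fin n) → ω₀ v ≤ n ∸ 1)
  × Σ (Permutation′ n) (λ σ → (v : Fin n) → conf (final (complete n) ω₀) v ≡ ω₀ (σ ⟨$⟩ʳ v))

-- Split the vertices of K_{3n+3} into a copy C of K_n carrying ω₀ + K, where K = 2n + 3
-- is the number of vertices outside C, a block A carrying ω₀, and a block B of n + 3
-- vertices carrying n + 2. Every C vertex has exactly K more dirty neighbours than its
-- twin in K_n, so the shift by K makes C fire exactly when K_n does, and after each
-- round it still carries the K_n configuration shifted by K. Meanwhile A and B stay
-- below the threshold and only collect one brush per cleaned C vertex. Once C is clean
-- (threshold 2n + 2), B fires with n + 2 + n brushes and keeps n + 2, so A receives
-- n + 3 more and holds ω₀ + K; in the last round all of A fires at once and keeps its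
-- brushes. The final configuration is ω with A and C exchanged through the relabelling
-- of K_n, and the count of brushes is 2 S_n + nK + (n + 3)(n + 2).

module Submission where

open import Defs
open import Data.Bool using (Bool; true; false; _∧_; not; if_then_else_)
open import Data.Bool.Properties using (T-≡; ∧-identityʳ; ∧-zeroʳ)
open import Data.Fin using (Fin; zero; suc; _↑ˡ_; _↑ʳ_; splitAt; join)
open import Data.Fin.Permutation using (Permutation′; _⟨$⟩ʳ_; _⟨$⟩ˡ_; permutation; inverseˡ; inverseʳ)
open import Data.Fin.Properties using (_≟_; join-splitAt)
open import Data.Nat using (ℕ; zero; suc; _+_; _*_; _∸_; _≤_; _<_; _≤ᵇ_; z≤n; s≤s)
open import Data.Nat.Properties hiding (_≟_)
open import Algebra.Properties.CommutativeSemigroup +-commutativeSemigroup using (interchange; xy∙z≈xz∙y)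
open import Data.Nat.Tactic.RingSolver using (solve-∀)
open import Data.Product using (Σ; _×_; _,_; proj₁; proj₂)
open import Data.Sum using ([_,_])
open import Data.Vec using () renaming (sum to vsum)
open import Data.Vec.Functional using (_++_; [])
open import Data.Vec.Functional.Properties using (lookup-++ˡ; lookup-++ʳ)
open import Data.Vec.Properties using (tabulate-cong)
open import Function using (_∘_; Equivalence)
open import Relation.Binary.PropositionalEquality
open import Relation.Nullary using (contradiction; yes; no)
open import Relation.Nullary.Decidable using (⌊_⌋)

𝟙 : Bool → ℕ
𝟙 b = if b then 1 else 0

sumV-cong : ∀ {m} {f g : Fin m → ℕ} → (∀ v → f v ≡ g v) → sumV f ≡ sumV g
sumV-cong eq = cong vsum (tabulate-cong eq)

sumV-+ : ∀ {m} (f g : Fin m → ℕ) → sumV (λ v → f v + g v) ≡ sumV f + sumV g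
sumV-+ {zero}  f g = refl
sumV-+ {suc m} f g =
  trans (cong (f zero + g zero +_) (sumV-+ (f ∘ suc) (g ∘ suc)))
        (interchange (f zero) (g zero) (sumV (f ∘ suc)) (sumV (g ∘ suc)))

sumV-const : ∀ m c → sumV {m} (λ _ → c) ≡ m * c
sumV-const zero    c = refl
sumV-const (suc m) c = cong (c +_) (sumV-const m c)

sumV-↑ : ∀ m k (f : Fin (m + k) → ℕ) →
         sumV f ≡ sumV (λ i → f (i ↑ˡ k)) + sumV (λ j → f (m ↑ʳ j))
sumV-↑ zero    k f = refl
sumV-↑ (suc m) k f =
  trans (cong (f zero +_) (sumV-↑ m k (f ∘ suc))) (sym (+-assoc (f zero) _ _))

countV-≤ : ∀ {m} (p : Fin m → Bool) → countV p ≤ m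
countV-≤ {zero}  p = z≤n
countV-≤ {suc m} p with p zero
... | true  = s≤s (countV-≤ (p ∘ suc))
... | false = m≤n⇒m≤1+n (countV-≤ (p ∘ suc))

countV-true : ∀ {m} (p : Fin m → Bool) → (∀ v → p v ≡ true) → countV p ≡ m
countV-true {m} p all = trans (sumV-cong (cong 𝟙 ∘ all)) (trans (sumV-const m 1) (*-identityʳ m))

countV-false : ∀ {m} (p : Fin m → Bool) → (∀ v → p v ≡ false) → countV p ≡ 0
countV-false {m} p none = trans (sumV-cong (cong 𝟙 ∘ none)) (trans (sumV-const m 0) (*-zeroʳ m))

countV-witness : ∀ {m} (p : Fin m → Bool) v → p v ≡ true → 1 ≤ countV p
countV-witness p zero    pv rewrite pv = s≤s z≤n
countV-witness p (suc v) pv = ≤-trans (countV-witness (p ∘ suc) v pv) (m≤n+m _ (𝟙 (p zero)))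

≤ᵇ-true : ∀ {a b} → a ≤ b → (a ≤ᵇ b) ≡ true
≤ᵇ-true a≤b = Equivalence.to T-≡ (≤⇒≤ᵇ a≤b)

≤ᵇ-true⁻¹ : ∀ {a b} → (a ≤ᵇ b) ≡ true → a ≤ b
≤ᵇ-true⁻¹ {a} {b} eq = ≤ᵇ⇒≤ a b (Equivalence.from T-≡ eq)

≤ᵇ-false : ∀ {a b} → b < a → (a ≤ᵇ b) ≡ false
≤ᵇ-false {a} {b} b<a with a ≤ᵇ b in eq
... | true  = contradiction (≤ᵇ-true⁻¹ eq) (<⇒≱ b<a)
... | false = refl

+-≤ᵇ-cancelˡ : ∀ k a b → (k + a ≤ᵇ k + b) ≡ (a ≤ᵇ b)
+-≤ᵇ-cancelˡ k a b with a ≤? b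
... | yes a≤b = trans (≤ᵇ-true (+-monoʳ-≤ k a≤b)) (sym (≤ᵇ-true a≤b))
... | no  a≰b = trans (≤ᵇ-false (+-monoʳ-< k (≰⇒> a≰b))) (sym (≤ᵇ-false (≰⇒> a≰b)))

∸-+-cancel : ∀ n a r → a + r ≤ n → n ∸ (a + r) + r ≡ n ∸ a
∸-+-cancel n a r a+r≤n = begin
  n ∸ (a + r) + r ≡⟨ cong (_+ r) (∸-+-assoc n a r) ⟨
  n ∸ a ∸ r + r   ≡⟨ m∸n+n≡m (m+n≤o⇒m≤o∸n r (≤-trans (≤-reflexive (+-comm r a)) a+r≤n)) ⟩
  n ∸ a           ∎
  where open ≡-Reasoning

CleanWith : ∀ {N} → Config N → State N → Set
CleanWith t X = ∀ v → dirty X v ≡ false × conf X v ≡ t v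

module _ {N} (G : Graph N) where

  step-clean : ∀ X v → dirty X v ≡ false →
               dirty (step G X) v ≡ false × conf (step G X) v ≡ conf X v
  step-clean X v clean rewrite clean = refl , refl

  idle⇒¬ρ : ∀ X → ρnonempty G X ≡ false → ∀ v → ρ G X v ≡ false
  idle⇒¬ρ X idle v with ρ G X v in fires
  ... | false = refl
  ... | true  = contradiction (trans (sym (≤ᵇ-true (countV-witness (ρ G X) v fires))) idle) λ ()

  clean⇒¬ρ : ∀ X v → dirty X v ≡ false → ρ G X v ≡ false
  clean⇒¬ρ X v clean = cong (_∧ (Dt G X v ≤ᵇ conf X v)) clean

  clean⇒idle : ∀ X → (∀ v → dirty X v ≡ false) → ρnonempty G X ≡ false
  clean⇒idle X clean = cong (1 ≤ᵇ_) (countV-false (ρ G X) (λ v → clean⇒¬ρ X v (clean v)))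

  run-clean : ∀ {t} X → CleanWith t X → ∀ k → CleanWith t (run G k X)
  run-clean X done zero    = done
  run-clean X done (suc k) rewrite clean⇒idle X (proj₁ ∘ done) = done

  run-suc : ∀ {t} X → CleanWith t (step G X) → ∀ k → CleanWith t (run G (suc k) X)
  run-suc {t} X done k with ρnonempty G X in fires
  ... | true  = run-clean (step G X) done k
  ... | false = unchanged
    where
    unchanged : CleanWith t X
    unchanged v = clean , trans (sym (proj₂ (step-clean X v clean))) (proj₂ (done v))
      where
      clean : dirty X v ≡ false
      clean = trans (sym (∧-identityʳ _))
                    (trans (cong (λ b → dirty X v ∧ not b) (sym (idle⇒¬ρ X fires v))) (proj₁ (done v)))

nbrCount-complete : ∀ {N} (S : Fin N → Bool) v → nbrCount (complete N) S v + 𝟙 (S v) ≡ countV S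
nbrCount-complete {suc N} S zero    = +-comm (countV (S ∘ suc)) (𝟙 (S zero))
nbrCount-complete {suc N} S (suc v) = begin
  𝟙 (S zero) + sumV (λ u → 𝟙 (not ⌊ suc v ≟ suc u ⌋ ∧ S' u)) + 𝟙 (S' v)
    ≡⟨ +-assoc (𝟙 (S zero)) _ _ ⟩
  𝟙 (S zero) + (sumV (λ u → 𝟙 (not ⌊ suc v ≟ suc u ⌋ ∧ S' u)) + 𝟙 (S' v))
    ≡⟨ cong (λ k → 𝟙 (S zero) + (k + 𝟙 (S' v)))
            (sumV-cong (λ u → cong (λ b → 𝟙 (not b ∧ S' u)) (≟-suc v u))) ⟩
  𝟙 (S zero) + (nbrCount (complete N) S' v + 𝟙 (S' v))
    ≡⟨ cong (𝟙 (S zero) +_) (nbrCount-complete S' v) ⟩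
  𝟙 (S zero) + countV S' ∎
  where
  open ≡-Reasoning
  S' : Fin N → Bool
  S' u = S (suc u)
  ≟-suc : ∀ (v u : Fin N) → ⌊ suc v ≟ suc u ⌋ ≡ ⌊ v ≟ u ⌋
  ≟-suc v u with v ≟ u
  ... | yes _ = refl
  ... | no _  = refl

module _ {N} (S : Fin N → Bool) (v : Fin N) where

  nbrCount-complete-∈ : S v ≡ true → nbrCount (complete N) S v ≡ countV S ∸ 1
  nbrCount-complete-∈ in-S = begin
    nbrCount (complete N) S v              ≡⟨ m+n∸n≡m _ 1 ⟨
    nbrCount (complete N) S v + 1 ∸ 1      ≡⟨ cong (λ b → nbrCount (complete N) S v + 𝟙 b ∸ 1) in-S ⟨
    nbrCount (complete N) S v + 𝟙 (S v) ∸ 1 ≡⟨ cong (_∸ 1) (nbrCount-complete S v) ⟩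
    countV S ∸ 1                           ∎
    where open ≡-Reasoning

  nbrCount-complete-∉ : S v ≡ false → nbrCount (complete N) S v ≡ countV S
  nbrCount-complete-∉ out-S = begin
    nbrCount (complete N) S v           ≡⟨ +-identityʳ _ ⟨
    nbrCount (complete N) S v + 0       ≡⟨ cong (λ b → nbrCount (complete N) S v + 𝟙 b) out-S ⟨
    nbrCount (complete N) S v + 𝟙 (S v) ≡⟨ nbrCount-complete S v ⟩
    countV S                            ∎
    where open ≡-Reasoning

dirtyCount : ∀ {N} → State N → ℕ
dirtyCount X = countV (dirty X)

firingCount : ∀ {N} → State N → ℕ
firingCount {N} X = countV (ρ (complete N) X)

module _ {N} (X : State N) where
  private
    Kₙ = complete N

  ρ⇒dirty : ∀ v → ρ Kₙ X v ≡ true → dirty X v ≡ true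
  ρ⇒dirty v fires with dirty X v
  ... | true = refl

  ρ-complete : ∀ v → ρ Kₙ X v ≡ dirty X v ∧ (dirtyCount X ∸ 1 ≤ᵇ conf X v)
  ρ-complete v with dirty X v in d
  ... | true  = cong (_≤ᵇ conf X v) (nbrCount-complete-∈ (dirty X) v d)
  ... | false = refl

  step-fired : ∀ v → ρ Kₙ X v ≡ true →
    conf (step Kₙ X) v ≡ conf X v ∸ (dirtyCount X ∸ 1) + (firingCount X ∸ 1)
  step-fired v fires rewrite fires | ρ⇒dirty v fires =
    cong₂ (λ a b → conf X v ∸ a + b)
          (nbrCount-complete-∈ (dirty X) v (ρ⇒dirty v fires))
          (nbrCount-complete-∈ (ρ Kₙ X) v fires)

  step-waiting : ∀ v → dirty X v ≡ true → ρ Kₙ X v ≡ false →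
    dirty (step Kₙ X) v ≡ true × conf (step Kₙ X) v ≡ conf X v + firingCount X
  step-waiting v d waits with nbrCount-complete-∉ (ρ Kₙ X) v waits
  ... | firing rewrite waits | d = refl , cong (conf X v +_) firing

  dirtyCount-step : dirtyCount (step Kₙ X) + firingCount X ≡ dirtyCount X
  dirtyCount-step =
    trans (sym (sumV-+ (𝟙 ∘ dirty (step Kₙ X)) (𝟙 ∘ ρ Kₙ X)))
          (sumV-cong λ v → split (dirty X v) (ρ Kₙ X v) (ρ⇒dirty v))
    where
    split : ∀ d r → (r ≡ true → d ≡ true) → 𝟙 (d ∧ not r) + 𝟙 r ≡ 𝟙 d
    split d     false _ = trans (+-identityʳ _) (cong 𝟙 (∧-identityʳ d))
    split true  true  _ = refl
    split false true  r⇒d with () ← r⇒d refl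

  firingCount≤dirtyCount : firingCount X ≤ dirtyCount X
  firingCount≤dirtyCount = ≤-trans (m≤n+m _ _) (≤-reflexive dirtyCount-step)

  ρnonempty⇒1≤dirtyCount : ρnonempty Kₙ X ≡ true → 1 ≤ dirtyCount X
  ρnonempty⇒1≤dirtyCount fires = ≤-trans (≤ᵇ-true⁻¹ fires) firingCount≤dirtyCount

  step-all-ready : (∀ v → dirty X v ≡ true → dirtyCount X ∸ 1 ≤ conf X v) →
                   CleanWith (conf X) (step Kₙ X)
  step-all-ready ready v = by-status (dirty X v) refl
    where
    ρ≡dirty : ∀ u → ρ Kₙ X u ≡ dirty X u
    ρ≡dirty u = trans (ρ-complete u) (implied (dirty X u) (≤ᵇ-true ∘ ready u))
      where
      implied : ∀ d {b} → (d ≡ true → b ≡ true) → d ∧ b ≡ d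
      implied true  d⇒b = d⇒b refl
      implied false d⇒b = refl

    by-status : ∀ b → dirty X v ≡ b → dirty (step Kₙ X) v ≡ false × conf (step Kₙ X) v ≡ conf X v
    by-status false d = step-clean Kₙ X v d
    by-status true  d = trans (cong (λ b → dirty X v ∧ not b) fires) (∧-zeroʳ _) , (begin
      conf (step Kₙ X) v                                   ≡⟨ step-fired v fires ⟩
      conf X v ∸ (dirtyCount X ∸ 1) + (firingCount X ∸ 1)  ≡⟨ cong (λ r → conf X v ∸ (dirtyCount X ∸ 1) + (r ∸ 1))
                                                                   (sumV-cong (cong 𝟙 ∘ ρ≡dirty)) ⟩
      conf X v ∸ (dirtyCount X ∸ 1) + (dirtyCount X ∸ 1)   ≡⟨ m∸n+n≡m (ready v d) ⟩
      conf X v                                             ∎)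
      where
      open ≡-Reasoning
      fires : ρ Kₙ X v ≡ true
      fires = trans (ρ≡dirty v) d

↑-elim : ∀ m k (P : Fin (m + k) → Set) → (∀ i → P (i ↑ˡ k)) → (∀ j → P (m ↑ʳ j)) → ∀ v → P v
↑-elim m k P left right v =
  subst P (join-splitAt m k v) ([_,_] {C = P ∘ join m k} left right (splitAt m v))

-- 3 * n + 3 normalises to (n + (n + (n + 0))) + 3; A and C are the first two blocks of n
-- vertices, and B consists of the third block together with the last three vertices.
module Blocks (n : ℕ) where

  N : ℕ
  N = 3 * n + 3

  bA bC : Fin n → Fin N
  bA i = (i ↑ˡ (n + (n + 0))) ↑ˡ 3
  bC i = (n ↑ʳ (i ↑ˡ (n + 0))) ↑ˡ 3

  private
    bB₁ : Fin n → Fin N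
    bB₁ i = (n ↑ʳ (n ↑ʳ (i ↑ˡ 0))) ↑ˡ 3
    bB₂ : Fin 3 → Fin N
    bB₂ = (n + (n + (n + 0))) ↑ʳ_

  bB : Fin (n + 3) → Fin N
  bB = bB₁ ++ bB₂

  blocks : ∀ {X : Set} → (Fin n → X) → (Fin n → X) → (Fin (n + 3) → X) → Fin N → X
  blocks a c b = (a ++ (c ++ ((b ∘ (_↑ˡ 3)) ++ []))) ++ (b ∘ (n ↑ʳ_))

  module _ {X : Set} (a c : Fin n → X) (b : Fin (n + 3) → X) where
    private
      b₁ = b ∘ (_↑ˡ 3)
      b₂ = b ∘ (n ↑ʳ_)

    blocks-A : ∀ i → blocks a c b (bA i) ≡ a i
    blocks-A i = trans (lookup-++ˡ (a ++ (c ++ (b₁ ++ []))) b₂ _) (lookup-++ˡ a (c ++ (b₁ ++ [])) i)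

    blocks-C : ∀ i → blocks a c b (bC i) ≡ c i
    blocks-C i = trans (lookup-++ˡ (a ++ (c ++ (b₁ ++ []))) b₂ _)
                (trans (lookup-++ʳ a (c ++ (b₁ ++ [])) _) (lookup-++ˡ c (b₁ ++ []) i))

    blocks-B : ∀ j → blocks a c b (bB j) ≡ b j
    blocks-B = ↑-elim n 3 (λ j → blocks a c b (bB j) ≡ b j)
      (λ i → trans (cong (blocks a c b) (lookup-++ˡ bB₁ bB₂ i))
             (trans (lookup-++ˡ (a ++ (c ++ (b₁ ++ []))) b₂ _)
             (trans (lookup-++ʳ a (c ++ (b₁ ++ [])) _)
             (trans (lookup-++ʳ c (b₁ ++ []) _) (lookup-++ˡ b₁ [] i)))))
      (λ k → trans (cong (blocks a c b) (lookup-++ʳ bB₁ bB₂ k)) (lookup-++ʳ (a ++ (c ++ (b₁ ++ []))) b₂ k))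

  blocks-elim : (P : Fin N → Set) → (∀ i → P (bA i)) → (∀ i → P (bC i)) → (∀ j → P (bB j)) → ∀ v → P v
  blocks-elim P pa pc pb = ↑-elim (n + (n + (n + 0))) 3 P
    (↑-elim n (n + (n + 0)) (λ x → P (x ↑ˡ 3)) pa
      (↑-elim n (n + 0) (λ x → P ((n ↑ʳ x) ↑ˡ 3)) pc
        (↑-elim n 0 (λ x → P ((n ↑ʳ (n ↑ʳ x)) ↑ˡ 3)) (λ i → subst P (lookup-++ˡ bB₁ bB₂ i) (pb (i ↑ˡ 3))) λ ())))
    (λ k → subst P (lookup-++ʳ bB₁ bB₂ k) (pb (n ↑ʳ k)))

  sumV-blocks : (f : Fin N → ℕ) → sumV f ≡ sumV (f ∘ bA) + sumV (f ∘ bC) + sumV (f ∘ bB)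
  sumV-blocks f = begin
    sumV f
      ≡⟨ sumV-↑ (n + (n + (n + 0))) 3 f ⟩
    sumV (λ x → f (x ↑ˡ 3)) + sumV (f ∘ bB₂)
      ≡⟨ cong (_+ sumV (f ∘ bB₂)) (sumV-↑ n (n + (n + 0)) _) ⟩
    sumV (f ∘ bA) + sumV (λ x → f ((n ↑ʳ x) ↑ˡ 3)) + sumV (f ∘ bB₂)
      ≡⟨ cong (λ s → sumV (f ∘ bA) + s + sumV (f ∘ bB₂)) (sumV-↑ n (n + 0) _) ⟩
    sumV (f ∘ bA) + (sumV (f ∘ bC) + sumV (λ x → f ((n ↑ʳ (n ↑ʳ x)) ↑ˡ 3))) + sumV (f ∘ bB₂)
      ≡⟨ cong (λ s → sumV (f ∘ bA) + (sumV (f ∘ bC) + s) + sumV (f ∘ bB₂)) (trans (sumV-↑ n 0 _) (+-identityʳ _)) ⟩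
    sumV (f ∘ bA) + (sumV (f ∘ bC) + sumV (f ∘ bB₁)) + sumV (f ∘ bB₂)
      ≡⟨ trans (cong (_+ sumV (f ∘ bB₂)) (sym (+-assoc (sumV (f ∘ bA)) _ _))) (+-assoc (sumV (f ∘ bA) + sumV (f ∘ bC)) _ _) ⟩
    sumV (f ∘ bA) + sumV (f ∘ bC) + (sumV (f ∘ bB₁) + sumV (f ∘ bB₂))
      ≡⟨ cong (sumV (f ∘ bA) + sumV (f ∘ bC) +_) (sym (trans (sumV-↑ n 3 (f ∘ bB))
           (cong₂ _+_ (sumV-cong (cong f ∘ lookup-++ˡ bB₁ bB₂)) (sumV-cong (cong f ∘ lookup-++ʳ bB₁ bB₂))))) ⟩
    sumV (f ∘ bA) + sumV (f ∘ bC) + sumV (f ∘ bB) ∎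
    where open ≡-Reasoning

  module _ (σ : Permutation′ n) where
    private
      to from : Fin N → Fin N
      to   = blocks bC (bA ∘ (σ ⟨$⟩ʳ_)) bB
      from = blocks (bC ∘ (σ ⟨$⟩ˡ_)) bA bB

      to-from : ∀ v → to (from v) ≡ v
      to-from = blocks-elim (λ v → to (from v) ≡ v)
        (λ i → trans (cong to (blocks-A _ bA bB i)) (trans (blocks-C bC _ bB _) (cong bA (inverseʳ σ))))
        (λ i → trans (cong to (blocks-C _ bA bB i)) (blocks-A bC _ bB i))
        (λ j → trans (cong to (blocks-B _ bA bB j)) (blocks-B bC _ bB j))

      from-to : ∀ v → from (to v) ≡ v
      from-to = blocks-elim (λ v → from (to v) ≡ v)
        (λ i → trans (cong from (blocks-A bC _ bB i)) (blocks-C _ bA bB i))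
        (λ i → trans (cong from (blocks-C bC _ bB i)) (trans (blocks-A _ bA bB _) (cong bC (inverseˡ σ))))
        (λ j → trans (cong from (blocks-B bC _ bB j)) (blocks-B _ bA bB j))

    swapAC : Permutation′ N
    swapAC = permutation to from to-from from-to

    swapAC-A : ∀ i → swapAC ⟨$⟩ʳ bA i ≡ bC i
    swapAC-A = blocks-A bC _ bB

    swapAC-C : ∀ i → swapAC ⟨$⟩ʳ bC i ≡ bA (σ ⟨$⟩ʳ i)
    swapAC-C = blocks-C bC _ bB

    swapAC-B : ∀ j → swapAC ⟨$⟩ʳ bB j ≡ bB j
    swapAC-B = blocks-B bC _ bB

module Construction (n : ℕ) (ω₀ : Config n) (ω₀≤ : ∀ i → ω₀ i ≤ n ∸ 1) where
  open Blocks n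

  small : Graph n
  small = complete n

  big : Graph N
  big = complete N

  K : ℕ
  K = n + (n + 3)

  ω : Config N
  ω = blocks ω₀ (λ i → K + ω₀ i) (λ _ → n + 2)

  target : State n → Config N
  target s = blocks (λ i → K + ω₀ i) (conf s) (λ _ → n + 2)

  bonus : Bool → ℕ
  bonus d = if d then K else 0

  Waiting : State n → State N → Fin N → ℕ → Set
  Waiting s S v x = dirty S v ≡ true × conf S v ≡ x + (n ∸ dirtyCount s)

  -- A waiting vertex has received one brush from each of the n ∸ dirtyCount s cleaned C vertices.
  record Sim (s : State n) (S : State N) : Set where
    field
      A-waiting : ∀ i → Waiting s S (bA i) (ω₀ i)
      B-waiting : ∀ j → Waiting s S (bB j) (n + 2)
      C-dirty   : ∀ i → dirty S (bC i) ≡ dirty s i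
      C-conf    : ∀ i → conf S (bC i) ≡ bonus (dirty s i) + conf s i

  countV-blocks : (p : Fin N → Bool) → countV p ≡ countV (p ∘ bA) + countV (p ∘ bC) + countV (p ∘ bB)
  countV-blocks p = sumV-blocks (𝟙 ∘ p)

  ω₀≤n : ∀ i → ω₀ i ≤ n
  ω₀≤n i = ≤-trans (ω₀≤ i) (m∸n≤m n 1)

  waiting-below : ∀ x c → x ≤ n + 1 + c → x + (n ∸ c) < K + c ∸ 1
  waiting-below x c x≤ =
    subst (λ t → x + (n ∸ c) < t ∸ 1) (sym (rearrange n c)) (s≤s (+-mono-≤ x≤ (m∸n≤m n c)))
    where
    rearrange : ∀ n c → n + (n + 3) + c ≡ 2 + (n + 1 + c + n)
    rearrange = solve-∀

  module _ {s : State n} {S : State N} (sim : Sim s S) where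
    open Sim sim

    dirtyCount-Sim : dirtyCount S ≡ K + dirtyCount s
    dirtyCount-Sim = begin
      dirtyCount S
        ≡⟨ countV-blocks (dirty S) ⟩
      countV (dirty S ∘ bA) + countV (dirty S ∘ bC) + countV (dirty S ∘ bB)
        ≡⟨ cong₂ _+_ (cong₂ _+_ (countV-true _ (proj₁ ∘ A-waiting)) (sumV-cong (cong 𝟙 ∘ C-dirty)))
                     (countV-true _ (proj₁ ∘ B-waiting)) ⟩
      n + dirtyCount s + (n + 3)
        ≡⟨ xy∙z≈xz∙y n (dirtyCount s) (n + 3) ⟩
      K + dirtyCount s ∎
      where open ≡-Reasoning

    threshold-Sim : dirtyCount S ∸ 1 ≡ K + dirtyCount s ∸ 1
    threshold-Sim = cong (_∸ 1) dirtyCount-Sim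

    waiting-stays : ∀ {v x} → Waiting s S v x → x ≤ n + 1 + dirtyCount s → ρ big S v ≡ false
    waiting-stays {v} {x} (d , c) x≤ =
      trans (ρ-complete S v)
            (cong₂ _∧_ d (trans (cong₂ _≤ᵇ_ threshold-Sim c) (≤ᵇ-false (waiting-below x _ x≤))))

    A-stays : ∀ i → ρ big S (bA i) ≡ false
    A-stays i = waiting-stays (A-waiting i) (≤-trans (ω₀≤n i) (≤-trans (m≤m+n n 1) (m≤m+n (n + 1) _)))

    module _ (busy : 1 ≤ dirtyCount s) where

      B-stays : ∀ j → ρ big S (bB j) ≡ false
      B-stays j = waiting-stays (B-waiting j) (≤-trans (≤-reflexive (sym (+-assoc n 1 1))) (+-monoʳ-≤ (n + 1) busy))

      threshold-big : dirtyCount S ∸ 1 ≡ K + (dirtyCount s ∸ 1)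
      threshold-big = trans threshold-Sim (+-∸-assoc K busy)

      C-fires-iff : ∀ i → ρ big S (bC i) ≡ ρ small s i
      C-fires-iff i = begin
        ρ big S (bC i)
          ≡⟨ ρ-complete S (bC i) ⟩
        dirty S (bC i) ∧ (dirtyCount S ∸ 1 ≤ᵇ conf S (bC i))
          ≡⟨ cong₂ (λ d t → d ∧ (t ≤ᵇ conf S (bC i))) (C-dirty i) threshold-big ⟩
        dirty s i ∧ (K + (dirtyCount s ∸ 1) ≤ᵇ conf S (bC i))
          ≡⟨ cong (λ x → dirty s i ∧ (K + (dirtyCount s ∸ 1) ≤ᵇ x)) (C-conf i) ⟩
        dirty s i ∧ (K + (dirtyCount s ∸ 1) ≤ᵇ bonus (dirty s i) + conf s i)
          ≡⟨ shifted (dirty s i) ⟩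
        dirty s i ∧ (dirtyCount s ∸ 1 ≤ᵇ conf s i)
          ≡⟨ ρ-complete s i ⟨
        ρ small s i ∎
        where
        open ≡-Reasoning
        shifted : ∀ d → d ∧ (K + (dirtyCount s ∸ 1) ≤ᵇ bonus d + conf s i)
                      ≡ d ∧ (dirtyCount s ∸ 1 ≤ᵇ conf s i)
        shifted true  = +-≤ᵇ-cancelˡ K (dirtyCount s ∸ 1) (conf s i)
        shifted false = refl

      firingCount-Sim : firingCount S ≡ firingCount s
      firingCount-Sim = begin
        firingCount S
          ≡⟨ countV-blocks (ρ big S) ⟩
        countV (ρ big S ∘ bA) + countV (ρ big S ∘ bC) + countV (ρ big S ∘ bB)
          ≡⟨ cong₂ _+_ (cong (_+ countV (ρ big S ∘ bC)) (countV-false _ A-stays)) (countV-false _ B-stays) ⟩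
        countV (ρ big S ∘ bC) + 0
          ≡⟨ trans (+-identityʳ (countV (ρ big S ∘ bC))) (sumV-cong (cong 𝟙 ∘ C-fires-iff)) ⟩
        firingCount s ∎
        where open ≡-Reasoning

    module _ (fires : ρnonempty small s ≡ true) where
      private
        busy : 1 ≤ dirtyCount s
        busy = ρnonempty⇒1≤dirtyCount s fires

      ρnonempty-Sim : ρnonempty big S ≡ true
      ρnonempty-Sim = trans (cong (1 ≤ᵇ_) (firingCount-Sim busy)) fires

      received : n ∸ dirtyCount s + firingCount s ≡ n ∸ dirtyCount (step small s)
      received = begin
        n ∸ dirtyCount s + firingCount s
          ≡⟨ cong (λ c → n ∸ c + firingCount s) (dirtyCount-step s) ⟨
        n ∸ (dirtyCount (step small s) + firingCount s) + firingCount s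
          ≡⟨ ∸-+-cancel n (dirtyCount (step small s)) (firingCount s)
                        (subst (_≤ n) (sym (dirtyCount-step s)) (countV-≤ (dirty s))) ⟩
        n ∸ dirtyCount (step small s) ∎
        where open ≡-Reasoning

      keeps-waiting : ∀ {v x} → Waiting s S v x → ρ big S v ≡ false →
                      Waiting (step small s) (step big S) v x
      keeps-waiting {v} {x} (d , c) stays = proj₁ (step-waiting S v d stays) , (begin
        conf (step big S) v                    ≡⟨ proj₂ (step-waiting S v d stays) ⟩
        conf S v + firingCount S               ≡⟨ cong₂ _+_ c (firingCount-Sim busy) ⟩
        x + (n ∸ dirtyCount s) + firingCount s ≡⟨ +-assoc x _ _ ⟩
        x + (n ∸ dirtyCount s + firingCount s) ≡⟨ cong (x +_) received ⟩
        x + (n ∸ dirtyCount (step small s))    ∎)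
        where open ≡-Reasoning

      C-fired : ∀ i → ρ small s i ≡ true →
                conf (step big S) (bC i) ≡ bonus (dirty (step small s) i) + conf (step small s) i
      C-fired i fired = begin
        conf (step big S) (bC i)
          ≡⟨ step-fired S (bC i) (trans (C-fires-iff busy i) fired) ⟩
        conf S (bC i) ∸ (dirtyCount S ∸ 1) + (firingCount S ∸ 1)
          ≡⟨ cong₂ (λ x t → x ∸ t + (firingCount S ∸ 1)) with-bonus (threshold-big busy) ⟩
        K + conf s i ∸ (K + (dirtyCount s ∸ 1)) + (firingCount S ∸ 1)
          ≡⟨ cong₂ _+_ ([m+n]∸[m+o]≡n∸o K _ _) (cong (_∸ 1) (firingCount-Sim busy)) ⟩
        conf s i ∸ (dirtyCount s ∸ 1) + (firingCount s ∸ 1)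
          ≡⟨ step-fired s i fired ⟨
        conf (step small s) i
          ≡⟨ cong (λ d → bonus d + conf (step small s) i) cleared ⟨
        bonus (dirty (step small s) i) + conf (step small s) i ∎
        where
        open ≡-Reasoning
        with-bonus : conf S (bC i) ≡ K + conf s i
        with-bonus = trans (C-conf i) (cong (λ d → bonus d + conf s i) (ρ⇒dirty s i fired))
        cleared : dirty (step small s) i ≡ false
        cleared = trans (cong (λ r → dirty s i ∧ not r) fired) (∧-zeroʳ _)

      C-waiting : ∀ i → dirty s i ≡ true → ρ small s i ≡ false →
                  conf (step big S) (bC i) ≡ bonus (dirty (step small s) i) + conf (step small s) i
      C-waiting i d waits = begin
        conf (step big S) (bC i)
          ≡⟨ proj₂ (step-waiting S (bC i) (trans (C-dirty i) d) (trans (C-fires-iff busy i) waits)) ⟩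
        conf S (bC i) + firingCount S
          ≡⟨ cong₂ _+_ (trans (C-conf i) (cong (λ d → bonus d + conf s i) d)) (firingCount-Sim busy) ⟩
        K + conf s i + firingCount s
          ≡⟨ +-assoc K _ _ ⟩
        K + (conf s i + firingCount s)
          ≡⟨ cong₂ (λ d x → bonus d + x) (proj₁ small-waits) (proj₂ small-waits) ⟨
        bonus (dirty (step small s) i) + conf (step small s) i ∎
        where
        open ≡-Reasoning
        small-waits : dirty (step small s) i ≡ true × conf (step small s) i ≡ conf s i + firingCount s
        small-waits = step-waiting s i d waits

      C-clean : ∀ i → dirty s i ≡ false →
                conf (step big S) (bC i) ≡ bonus (dirty (step small s) i) + conf (step small s) i
      C-clean i clean = begin
        conf (step big S) (bC i)
          ≡⟨ proj₂ (step-clean big S (bC i) (trans (C-dirty i) clean)) ⟩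
        conf S (bC i)
          ≡⟨ C-conf i ⟩
        bonus (dirty s i) + conf s i
          ≡⟨ cong₂ (λ d x → bonus d + x) (trans (proj₁ still-clean) (sym clean)) (proj₂ still-clean) ⟨
        bonus (dirty (step small s) i) + conf (step small s) i ∎
        where
        open ≡-Reasoning
        still-clean : dirty (step small s) i ≡ false × conf (step small s) i ≡ conf s i
        still-clean = step-clean small s i clean

      C-step : ∀ i r d → ρ small s i ≡ r → dirty s i ≡ d →
               conf (step big S) (bC i) ≡ bonus (dirty (step small s) i) + conf (step small s) i
      C-step i true  _     fired _ = C-fired i fired
      C-step i false true  waits d = C-waiting i d waits
      C-step i _     false _ clean = C-clean i clean

      sim-step : Sim (step small s) (step big S)
      sim-step = record
        { A-waiting = λ i → keeps-waiting (A-waiting i) (A-stays i)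
        ; B-waiting = λ j → keeps-waiting (B-waiting j) (B-stays busy j)
        ; C-dirty   = λ i → cong₂ (λ d r → d ∧ not r) (C-dirty i) (C-fires-iff busy i)
        ; C-conf    = λ i → C-step i (ρ small s i) (dirty s i) refl refl
        }

    module _ (done : ∀ i → dirty s i ≡ false) where
      private
        S₁ : State N
        S₁ = step big S

      dirtyCount≡0 : dirtyCount s ≡ 0
      dirtyCount≡0 = countV-false (dirty s) done

      B-threshold : dirtyCount S ∸ 1 ≡ n + 2 + (n ∸ dirtyCount s)
      B-threshold = begin
        dirtyCount S ∸ 1            ≡⟨ threshold-Sim ⟩
        K + dirtyCount s ∸ 1        ≡⟨ cong (λ c → K + c ∸ 1) dirtyCount≡0 ⟩
        K + 0 ∸ 1                   ≡⟨ cong (_∸ 1) (rearrange n) ⟩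
        n + 2 + n                   ≡⟨ cong (λ c → n + 2 + (n ∸ c)) dirtyCount≡0 ⟨
        n + 2 + (n ∸ dirtyCount s)  ∎
        where
        open ≡-Reasoning
        rearrange : ∀ n → n + (n + 3) + 0 ≡ 1 + (n + 2 + n)
        rearrange = solve-∀

      B-fires : ∀ j → ρ big S (bB j) ≡ true
      B-fires j = trans (ρ-complete S (bB j))
        (cong₂ _∧_ (proj₁ (B-waiting j)) (≤ᵇ-true (≤-reflexive (trans B-threshold (sym (proj₂ (B-waiting j)))))))

      C-done : ∀ i → dirty S (bC i) ≡ false
      C-done i = trans (C-dirty i) (done i)

      firingCount-finish : firingCount S ≡ n + 3
      firingCount-finish = begin
        firingCount S
          ≡⟨ countV-blocks (ρ big S) ⟩
        countV (ρ big S ∘ bA) + countV (ρ big S ∘ bC) + countV (ρ big S ∘ bB)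
          ≡⟨ cong₂ _+_ (cong₂ _+_ (countV-false _ A-stays) (countV-false _ (λ i → clean⇒¬ρ big S (bC i) (C-done i))))
                       (countV-true _ B-fires) ⟩
        n + 3 ∎
        where open ≡-Reasoning

      S₁-A : ∀ i → dirty S₁ (bA i) ≡ true × conf S₁ (bA i) ≡ K + ω₀ i
      S₁-A i = proj₁ waits , (begin
        conf S₁ (bA i)                           ≡⟨ proj₂ waits ⟩
        conf S (bA i) + firingCount S            ≡⟨ cong₂ _+_ (proj₂ (A-waiting i)) firingCount-finish ⟩
        ω₀ i + (n ∸ dirtyCount s) + (n + 3)      ≡⟨ cong (λ c → ω₀ i + (n ∸ c) + (n + 3)) dirtyCount≡0 ⟩
        ω₀ i + n + (n + 3)                       ≡⟨ trans (+-assoc (ω₀ i) n (n + 3)) (+-comm (ω₀ i) K) ⟩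
        K + ω₀ i                                 ∎)
        where
        open ≡-Reasoning
        waits : dirty S₁ (bA i) ≡ true × conf S₁ (bA i) ≡ conf S (bA i) + firingCount S
        waits = step-waiting S (bA i) (proj₁ (A-waiting i)) (A-stays i)

      S₁-B : ∀ j → dirty S₁ (bB j) ≡ false × conf S₁ (bB j) ≡ n + 2
      S₁-B j = trans (cong (λ r → dirty S (bB j) ∧ not r) (B-fires j)) (∧-zeroʳ _) , (begin
        conf S₁ (bB j)
          ≡⟨ step-fired S (bB j) (B-fires j) ⟩
        conf S (bB j) ∸ (dirtyCount S ∸ 1) + (firingCount S ∸ 1)
          ≡⟨ cong₂ (λ t r → conf S (bB j) ∸ t + (r ∸ 1))
                   (trans B-threshold (sym (proj₂ (B-waiting j)))) firingCount-finish ⟩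
        conf S (bB j) ∸ conf S (bB j) + (n + 3 ∸ 1)
          ≡⟨ cong₂ _+_ (n∸n≡0 (conf S (bB j))) (cong (_∸ 1) (+-suc n 2)) ⟩
        n + 2 ∎)
        where open ≡-Reasoning

      S₁-C : ∀ i → dirty S₁ (bC i) ≡ false × conf S₁ (bC i) ≡ conf s i
      S₁-C i = proj₁ still , trans (proj₂ still) (trans (C-conf i) (cong (λ d → bonus d + conf s i) (done i)))
        where
        still : dirty S₁ (bC i) ≡ false × conf S₁ (bC i) ≡ conf S (bC i)
        still = step-clean big S (bC i) (C-done i)

      S₁-conf : ∀ v → conf S₁ v ≡ target s v
      S₁-conf = blocks-elim (λ v → conf S₁ v ≡ target s v)
        (λ i → trans (proj₂ (S₁-A i)) (sym (blocks-A _ _ _ i)))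
        (λ i → trans (proj₂ (S₁-C i)) (sym (blocks-C _ _ _ i)))
        (λ j → trans (proj₂ (S₁-B j)) (sym (blocks-B _ _ _ j)))

      dirtyCount-S₁ : dirtyCount S₁ ≡ n
      dirtyCount-S₁ = begin
        dirtyCount S₁
          ≡⟨ countV-blocks (dirty S₁) ⟩
        countV (dirty S₁ ∘ bA) + countV (dirty S₁ ∘ bC) + countV (dirty S₁ ∘ bB)
          ≡⟨ cong₂ _+_ (cong₂ _+_ (countV-true _ (proj₁ ∘ S₁-A)) (countV-false _ (proj₁ ∘ S₁-C)))
                       (countV-false _ (proj₁ ∘ S₁-B)) ⟩
        n + 0 + 0
          ≡⟨ trans (+-identityʳ _) (+-identityʳ n) ⟩
        n ∎
        where open ≡-Reasoning

      S₁-ready : ∀ v → dirty S₁ v ≡ true → dirtyCount S₁ ∸ 1 ≤ conf S₁ v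
      S₁-ready = blocks-elim (λ v → dirty S₁ v ≡ true → dirtyCount S₁ ∸ 1 ≤ conf S₁ v)
        (λ i _ → begin
          dirtyCount S₁ ∸ 1 ≡⟨ cong (_∸ 1) dirtyCount-S₁ ⟩
          n ∸ 1             ≤⟨ m∸n≤m n 1 ⟩
          n                 ≤⟨ m≤m+n n (n + 3) ⟩
          K                 ≤⟨ m≤m+n K (ω₀ i) ⟩
          K + ω₀ i          ≡⟨ proj₂ (S₁-A i) ⟨
          conf S₁ (bA i)    ∎)
        (λ i d → contradiction (trans (sym d) (proj₁ (S₁-C i))) λ ())
        (λ j d → contradiction (trans (sym d) (proj₁ (S₁-B j))) λ ())
        where open ≤-Reasoning

      ρnonempty-finish : ρnonempty big S ≡ true
      ρnonempty-finish = ≤ᵇ-true (subst (1 ≤_) (sym firingCount-finish) (≤-trans (s≤s z≤n) (m≤n+m 3 n)))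

      sim-finish : ∀ m → CleanWith (target s) (run big (2 + m) S)
      sim-finish m rewrite ρnonempty-finish = run-suc big S₁ S₂-clean m
        where
        S₂-clean : CleanWith (target s) (step big S₁)
        S₂-clean v = proj₁ (all-fire v) , trans (proj₂ (all-fire v)) (S₁-conf v)
          where
          all-fire : CleanWith (conf S₁) (step big S₁)
          all-fire = step-all-ready S₁ S₁-ready

  sim-run : ∀ k m {s S} → Sim s S → (∀ i → dirty (run small k s) i ≡ false) →
            CleanWith (target (run small k s)) (run big (k + (2 + m)) S)
  sim-run zero    m     sim done = sim-finish sim done m
  sim-run (suc k) m {s} {S} sim done with ρnonempty small s in fires
  ... | true rewrite ρnonempty-Sim sim fires = sim-run k m (sim-step sim fires) done
  ... | false = subst (λ f → CleanWith (target s) (run big f S)) (fuel k m) (sim-finish sim done (suc (k + m)))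
    where
    fuel : ∀ k m → 2 + suc (k + m) ≡ suc k + (2 + m)
    fuel = solve-∀

  s₀ : State n
  s₀ = ⟨ (λ _ → true) , ω₀ ⟩

  S₀ : State N
  S₀ = ⟨ (λ _ → true) , ω ⟩

  sim₀ : Sim s₀ S₀
  sim₀ = record
    { A-waiting = λ i → refl , trans (blocks-A _ _ _ i) (sym (nothing-received (ω₀ i)))
    ; B-waiting = λ j → refl , trans (blocks-B _ _ _ j) (sym (nothing-received (n + 2)))
    ; C-dirty   = λ i → refl
    ; C-conf    = blocks-C _ _ _
    }
    where
    nothing-received : ∀ x → x + (n ∸ dirtyCount s₀) ≡ x
    nothing-received x = begin
      x + (n ∸ dirtyCount s₀) ≡⟨ cong (λ c → x + (n ∸ c)) (countV-true (dirty s₀) (λ _ → refl)) ⟩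
      x + (n ∸ n)             ≡⟨ cong (x +_) (n∸n≡0 n) ⟩
      x + 0                   ≡⟨ +-identityʳ x ⟩
      x                       ∎
      where open ≡-Reasoning

  final-Sim : Cleans small ω₀ → CleanWith (target (final small ω₀)) (final big ω)
  final-Sim cleans = subst (λ f → CleanWith (target (final small ω₀)) (run big f S₀)) (fuel n)
                           (sim-run (suc n) (2 * n + 1) sim₀ cleans)
    where
    fuel : ∀ n → suc n + (2 + (2 * n + 1)) ≡ suc (3 * n + 3)
    fuel = solve-∀

  ω-bounded : ∀ v → ω v ≤ N ∸ 1
  ω-bounded = blocks-elim (λ v → ω v ≤ N ∸ 1)
    (λ i → fits (blocks-A _ _ _ i) (≤-trans (ω₀≤n i) (≤-trans n≤3n (m≤m+n (3 * n) 2))))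
    (λ i → fits (blocks-C _ _ _ i) (shifted-fits n i (ω₀≤ i)))
    (λ j → fits (blocks-B _ _ _ j) (+-monoˡ-≤ 2 n≤3n))
    where
    n≤3n : n ≤ 3 * n
    n≤3n = m≤m+n n (2 * n)
    fits : ∀ {v x} → ω v ≡ x → x ≤ 3 * n + 2 → ω v ≤ N ∸ 1
    fits {v} ωv≡x x≤ = subst₂ _≤_ (sym ωv≡x) (sym (cong (_∸ 1) (+-suc (3 * n) 2))) x≤
    shifted-fits : ∀ m → Fin m → ∀ {x} → x ≤ m ∸ 1 → m + (m + 3) + x ≤ 3 * m + 2
    shifted-fits (suc m) _ {x} x≤m = ≤-trans (+-monoʳ-≤ (suc m + (suc m + 3)) x≤m) (≤-reflexive (rearrange m))
      where
      rearrange : ∀ m → suc m + (suc m + 3) + m ≡ 3 * suc m + 2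
      rearrange = solve-∀

  ω-permuted : (σ : Permutation′ n) → (∀ i → conf (final small ω₀) i ≡ ω₀ (σ ⟨$⟩ʳ i)) →
               CleanWith (target (final small ω₀)) (final big ω) →
               ∀ v → conf (final big ω) v ≡ ω (swapAC σ ⟨$⟩ʳ v)
  ω-permuted σ permuted clean = blocks-elim (λ v → conf (final big ω) v ≡ ω (swapAC σ ⟨$⟩ʳ v))
    (λ i → begin
      conf (final big ω) (bA i)  ≡⟨ trans (proj₂ (clean (bA i))) (blocks-A _ _ _ i) ⟩
      K + ω₀ i                   ≡⟨ blocks-C _ _ _ i ⟨
      ω (bC i)                   ≡⟨ cong ω (swapAC-A σ i) ⟨
      ω (swapAC σ ⟨$⟩ʳ bA i)     ∎)
    (λ i → begin
      conf (final big ω) (bC i)  ≡⟨ trans (proj₂ (clean (bC i))) (blocks-C _ _ _ i) ⟩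
      conf (final small ω₀) i    ≡⟨ permuted i ⟩
      ω₀ (σ ⟨$⟩ʳ i)              ≡⟨ blocks-A _ _ _ (σ ⟨$⟩ʳ i) ⟨
      ω (bA (σ ⟨$⟩ʳ i))          ≡⟨ cong ω (swapAC-C σ i) ⟨
      ω (swapAC σ ⟨$⟩ʳ bC i)     ∎)
    (λ j → begin
      conf (final big ω) (bB j)  ≡⟨ trans (proj₂ (clean (bB j))) (blocks-B _ _ _ j) ⟩
      n + 2                      ≡⟨ blocks-B _ _ _ j ⟨
      ω (bB j)                   ≡⟨ cong ω (swapAC-B σ j) ⟨
      ω (swapAC σ ⟨$⟩ʳ bB j)     ∎)
    where open ≡-Reasoning

  brushes-ω : brushes ω ≡ 2 * brushes ω₀ + 3 * (n * n) + 8 * n + 6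
  brushes-ω = begin
    brushes ω
      ≡⟨ sumV-blocks ω ⟩
    sumV (ω ∘ bA) + sumV (ω ∘ bC) + sumV (ω ∘ bB)
      ≡⟨ cong₂ _+_ (cong₂ _+_ (sumV-cong (blocks-A _ _ _)) (sumV-cong (blocks-C _ _ _))) (sumV-cong (blocks-B _ _ _)) ⟩
    brushes ω₀ + sumV (λ i → K + ω₀ i) + sumV {n + 3} (λ _ → n + 2)
      ≡⟨ cong₂ _+_ (cong (brushes ω₀ +_) (trans (sumV-+ (λ _ → K) ω₀) (cong (_+ brushes ω₀) (sumV-const n K))))
                   (sumV-const (n + 3) (n + 2)) ⟩
    brushes ω₀ + (n * K + brushes ω₀) + (n + 3) * (n + 2)
      ≡⟨ count (brushes ω₀) n ⟩
    2 * brushes ω₀ + 3 * (n * n) + 8 * n + 6 ∎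
    where
    open ≡-Reasoning
    count : ∀ b n → b + (n * (n + (n + 3)) + b) + (n + 3) * (n + 2) ≡ 2 * b + 3 * (n * n) + 8 * n + 6
    count = solve-∀

mainTheorem4 : (n : ℕ) (ω₀ : Config n) → OneClique n ω₀ →
    Σ (Config (3 * n + 3)) (λ ω → OneClique (3 * n + 3) ω
      × brushes ω ≡ 2 * brushes ω₀ + 3 * (n * n) + 8 * n + 6)
mainTheorem4 n ω₀ (cleans , bounded , σ , permuted) =
  ω , (proj₁ ∘ clean , ω-bounded , swapAC σ , ω-permuted σ permuted clean) , brushes-ω
  where
  open Construction n ω₀ bounded
  open Blocks n using (swapAC)
  clean : CleanWith (target (final small ω₀)) (final big ω)
  clean = final-Sim cleans
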